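{- Let $(p,p')$ be positive integers with $|p-p'|=1$, let $Y$ be a finite word over $\{a,b\}$, and let $X=\alpha_{(p,p')}(Y)$ be a finite Sturmian word. Then: (i) $|K_{(X,a)}| = p|Y|_a + p'|Y|_b$; (ii) $|K_{(X,b)}| = |Y|$; (iii) $|K_{(X,aa)}| = (p-1)|Y|_a + (p'-1)|Y|_b$; (iv) $|K_X| = 2|X|-2|Y|$; moreover $|K_X| = 2|Y|_a + 2p'|Y|$ when $p>p'$, and $|K_X| = 2|Y|_b + 2p|Y|$ when $p<p'$.
   Context: Words are over the alphabet $\{a,b\}$. For a finite word $W$, $|W|$ is its length, $|W|_l$ the number of occurrences of the letter $l$ in $W$, and $W[i]$ its $i$-th letter. A Sturmian word is a right-infinite aperiodic word over $\{a,b\}$ of minimal factor complexity; a finite Sturmian word is a finite factor of a Sturmian word. For positive integers $p,p'$ with $|p-p'|=1$, $\alpha_{(p,p')}$ is the morphism $a\mapsto a^pb$, $b\mapsto a^{p'}b$. A palindrome is a word equal to its reverse. The center of a palindrome $P$ is its middle letter if $|P|$ is odd, and its two middle letters (necessarily $aa$) if $|P|$ is even; so centers are $a$, $b$ or $aa$. Each occurrence of $a$, of $b$, and of $aa$ in a word is the center of exactly one maximal palindrome occurrence (the longest palindromic factor centered there). For $c\in\{a,b,aa\}$, $K_{(X,c)}=\{(i,c) : c \text{ is a palindrome center in } X \text{ occurring at position } i \text{ (i.e. } X[i]=c[1]\text{)}\}$ is the set of maximal palindrome occurrences with center $c$ in $X$, and $K_X = K_{(X,a)}\cup K_{(X,aa)}\cup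 K_{(X,b)}$ is the set of all maximal palindrome occurrences in $X$. -}

module Defs where

open import Data.Nat using (ℕ; zero; suc; _+_; _*_; _∸_; _≤_; _<_; _≥_)
open import Data.List using (List; []; _∷_; _++_; length; map; filter; upTo; drop; concatMap)
open import Data.List.Relation.Unary.Unique.Propositional using (Unique)
open import Data.List.Membership.Propositional using (_∈_)
open import Data.Product using (Σ; ∃; _×_; _,_)
open import Data.Empty using (⊥)
open import Relation.Nullary using (¬_; Dec; yes; no)
open import Relation.Nullary.Decidable using (map′)
open import Relation.Binary.PropositionalEquality using (_≡_; refl)
open import Function.Bundles using (_⇔_)

data Letter : Set where
  a b : Letter

Word : Set
Word = List Letter

_≟L_ : (x y : Letter) → Dec (x ≡ y)
a ≟L a = yes refl
a ≟L b = no (λ ())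
b ≟L a = no (λ ())
b ≟L b = yes refl

count : Letter → Word → ℕ
count l [] = 0
count l (x ∷ w) with l ≟L x
... | yes _ = suc (count l w)
... | no  _ = count l w

rep : ℕ → Letter → Word
rep zero    l = []
rep (suc n) l = l ∷ rep n l

α : ℕ → ℕ → Word → Word
α p p' = concatMap img
  where
  img : Letter → Word
  img a = rep p a ++ (b ∷ [])
  img b = rep p' a ++ (b ∷ [])

InfWord : Set
InfWord = ℕ → Letter

slice : InfWord → ℕ → ℕ → Word
slice w i zero    = []
slice w i (suc n) = w i ∷ slice w (suc i) n

FactorOf : Word → InfWord → Set
FactorOf u w = ∃ λ i → slice w i (length u) ≡ u

HasComplexity : InfWord → ℕ → ℕ → Set
HasComplexity w n k =
  Σ (List Word) λ L → length L ≡ k × Unique L ×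
    ((u : Word) → (u ∈ L) ⇔ (length u ≡ n × FactorOf u w))

Aperiodic : InfWord → Set
Aperiodic w = ¬ (Σ ℕ λ n₀ → Σ ℕ λ t → 1 ≤ t × ((n : ℕ) → n₀ ≤ n → w (n + t) ≡ w n))

Sturmian : InfWord → Set
Sturmian w = Aperiodic w × ((n : ℕ) → HasComplexity w n (suc n))

FiniteSturmian : Word → Set
FiniteSturmian u = Σ InfWord λ w → Sturmian w × FactorOf u w

isPrefix : (u v : Word) → Dec (Σ Word λ r → u ++ r ≡ v)
isPrefix [] v = yes (v , refl)
isPrefix (x ∷ u) [] = no λ { (_ , ()) }
isPrefix (x ∷ u) (y ∷ v) with x ≟L y | isPrefix u v
... | yes refl | yes (r , refl) = yes (r , refl)
... | yes refl | no ¬p = no λ { (r , refl) → ¬p (r , refl) }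
... | no x≢y | _ = no λ { (r , refl) → x≢y refl }

OccursAt : Word → Word → ℕ → Set
OccursAt c X i = Σ Word λ r → c ++ r ≡ drop i X

occursAt? : (c X : Word) (i : ℕ) → Dec (OccursAt c X i)
occursAt? c X i = isPrefix c (drop i X)

cA cB cAA : Word
cA  = a ∷ []
cB  = b ∷ []
cAA = a ∷ a ∷ []

-- K_(X,c) : the (position, center) pairs of maximal palindrome occurrences
-- with center c in X, one for each occurrence of c in X
K : Word → Word → List (ℕ × Word)
K X c = map (λ i → (i , c)) (filter (occursAt? c X) (upTo (length X)))

-- K_X = K_(X,a) ∪ K_(X,aa) ∪ K_(X,b)  (disjoint: distinct centers)
KAll : Word → List (ℕ × Word)
KAll X = K X cA ++ K X cAA ++ K X cB

-- Each occurrence of a, b or aa in X is the center of exactly one maximal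
-- palindrome, so |K_(X,c)| is the number of occurrences of c in X.  Reading
-- X = α_(p,p')(Y) block by block, the block a^k b contributes k letters a, one
-- letter b and k - 1 factors aa; summing over the blocks of Y gives (i)-(iii),
-- and (iv) is their sum compared with |X| = p|Y|_a + p'|Y|_b + |Y|.
module Submission where

open import Defs
open import Data.Bool using (if_then_else_)
open import Data.Empty using (⊥-elim)
open import Data.List using ([]; _∷_; _++_; length; filter; applyUpTo; upTo)
open import Data.List.Properties using (length-++; length-map)
open import Data.Nat using (ℕ; zero; suc; _+_; _*_; _∸_; _≤_; _<_)
open import Data.Nat.Properties using (+-suc; *-distribˡ-+; m+n∸n≡m; <-asym; n<1+n)
open import Data.Nat.Tactic.RingSolver using (solve-∀)
open import Data.Product using (_×_; _,_)
open import Data.Sum using (_⊎_; inj₁; inj₂)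
open import Relation.Nullary using (yes; no; does)
open import Relation.Binary.PropositionalEquality
  using (_≡_; refl; cong; cong₂; sym; trans; module ≡-Reasoning)
open ≡-Reasoning

occurrenceCount : Word → Word → ℕ
occurrenceCount c X = length (filter (occursAt? c X) (upTo (length X)))

length-K : ∀ X c → length (K X c) ≡ occurrenceCount c X
length-K X c = length-map _ (filter (occursAt? c X) (upTo (length X)))

-- Definitionally, occursAt? c (x ∷ X) (suc i) is occursAt? c X i.
filter-occursAt?-∷ : ∀ c x X n (g : ℕ → ℕ) →
  length (filter (occursAt? c (x ∷ X)) (applyUpTo (λ i → suc (g i)) n))
  ≡ length (filter (occursAt? c X) (applyUpTo g n))
filter-occursAt?-∷ c x X zero    g = refl
filter-occursAt?-∷ c x X (suc n) g with occursAt? c X (g 0)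
... | yes _ = cong suc (filter-occursAt?-∷ c x X n (λ i → g (suc i)))
... | no  _ = filter-occursAt?-∷ c x X n (λ i → g (suc i))

occurrenceCount-∷ : ∀ c x X → occurrenceCount c (x ∷ X) ≡
  (if does (isPrefix c (x ∷ X)) then 1 else 0) + occurrenceCount c X
occurrenceCount-∷ c x X with isPrefix c (x ∷ X)
... | yes _ = cong suc (filter-occursAt?-∷ c x X (length X) (λ i → i))
... | no  _ = filter-occursAt?-∷ c x X (length X) (λ i → i)

occurrenceCount-letter : ∀ l X → occurrenceCount (l ∷ []) X ≡ count l X
occurrenceCount-letter l []      = refl
occurrenceCount-letter l (x ∷ X) with l ≟L x | occurrenceCount-∷ (l ∷ []) x X
... | yes refl | eq = trans eq (cong suc (occurrenceCount-letter l X))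
... | no  _    | eq = trans eq (occurrenceCount-letter l X)

countAA : Word → ℕ
countAA []          = 0
countAA (a ∷ [])    = 0
countAA (a ∷ a ∷ X) = suc (countAA (a ∷ X))
countAA (a ∷ b ∷ X) = countAA (b ∷ X)
countAA (b ∷ X)     = countAA X

occurrenceCount-aa : ∀ X → occurrenceCount cAA X ≡ countAA X
occurrenceCount-aa []          = refl
occurrenceCount-aa (a ∷ [])    = refl
occurrenceCount-aa (a ∷ a ∷ X) =
  trans (occurrenceCount-∷ cAA a (a ∷ X)) (cong suc (occurrenceCount-aa (a ∷ X)))
occurrenceCount-aa (a ∷ b ∷ X) =
  trans (occurrenceCount-∷ cAA a (b ∷ X)) (occurrenceCount-aa (b ∷ X))
occurrenceCount-aa (b ∷ X)     =
  trans (occurrenceCount-∷ cAA b X) (occurrenceCount-aa X)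

count-++ : ∀ l u v → count l (u ++ v) ≡ count l u + count l v
count-++ l []      v = refl
count-++ l (x ∷ u) v with l ≟L x
... | yes _ = cong suc (count-++ l u v)
... | no  _ = count-++ l u v

length≡count-a+count-b : ∀ X → length X ≡ count a X + count b X
length≡count-a+count-b []      = refl
length≡count-a+count-b (a ∷ X) = cong suc (length≡count-a+count-b X)
length≡count-a+count-b (b ∷ X) =
  trans (cong suc (length≡count-a+count-b X)) (sym (+-suc (count a X) (count b X)))

block : ℕ → Word
block k = rep k a ++ b ∷ []

count-a-block : ∀ k → count a (block k) ≡ k
count-a-block zero    = refl
count-a-block (suc k) = cong suc (count-a-block k)

count-b-block : ∀ k → count b (block k) ≡ 1
count-b-block zero    = refl
count-b-block (suc k) = count-b-block k

countAA-block-++ : ∀ k X → countAA (block k ++ X) ≡ k ∸ 1 + countAA X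
countAA-block-++ zero          X = refl
countAA-block-++ (suc zero)    X = refl
countAA-block-++ (suc (suc k)) X = cong suc (countAA-block-++ (suc k) X)

module _ (p p' : ℕ) where

  private
    blocks-step : ∀ r r' m n → r + (r * m + r' * n) ≡ r * suc m + r' * n
    blocks-step = solve-∀

    blocks-step′ : ∀ r r' m n → r' + (r * m + r' * n) ≡ r * m + r' * suc n
    blocks-step′ = solve-∀

    no-blocks : ∀ r r' → 0 ≡ r * 0 + r' * 0
    no-blocks = solve-∀

  count-a-α : ∀ Y → count a (α p p' Y) ≡ p * count a Y + p' * count b Y
  count-a-α []      = no-blocks p p'
  count-a-α (a ∷ Y) = begin
    count a (block p ++ α p p' Y)                ≡⟨ count-++ a (block p) (α p p' Y) ⟩
    count a (block p) + count a (α p p' Y)       ≡⟨ cong₂ _+_ (count-a-block p) (count-a-α Y) ⟩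
    p + (p * count a Y + p' * count b Y)         ≡⟨ blocks-step p p' (count a Y) (count b Y) ⟩
    p * suc (count a Y) + p' * count b Y         ∎
  count-a-α (b ∷ Y) = begin
    count a (block p' ++ α p p' Y)               ≡⟨ count-++ a (block p') (α p p' Y) ⟩
    count a (block p') + count a (α p p' Y)      ≡⟨ cong₂ _+_ (count-a-block p') (count-a-α Y) ⟩
    p' + (p * count a Y + p' * count b Y)        ≡⟨ blocks-step′ p p' (count a Y) (count b Y) ⟩
    p * count a Y + p' * suc (count b Y)         ∎

  count-b-α : ∀ Y → count b (α p p' Y) ≡ length Y
  count-b-α []      = refl
  count-b-α (a ∷ Y) = trans (count-++ b (block p) (α p p' Y))
                            (cong₂ _+_ (count-b-block p) (count-b-α Y))
  count-b-α (b ∷ Y) = trans (count-++ b (block p') (α p p' Y))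
                            (cong₂ _+_ (count-b-block p') (count-b-α Y))

  countAA-α : ∀ Y → countAA (α p p' Y) ≡ (p ∸ 1) * count a Y + (p' ∸ 1) * count b Y
  countAA-α []      = no-blocks (p ∸ 1) (p' ∸ 1)
  countAA-α (a ∷ Y) = begin
    countAA (block p ++ α p p' Y)                         ≡⟨ countAA-block-++ p (α p p' Y) ⟩
    p ∸ 1 + countAA (α p p' Y)                            ≡⟨ cong (p ∸ 1 +_) (countAA-α Y) ⟩
    p ∸ 1 + ((p ∸ 1) * count a Y + (p' ∸ 1) * count b Y)  ≡⟨ blocks-step (p ∸ 1) (p' ∸ 1) (count a Y) (count b Y) ⟩
    (p ∸ 1) * suc (count a Y) + (p' ∸ 1) * count b Y      ∎
  countAA-α (b ∷ Y) = begin
    countAA (block p' ++ α p p' Y)                        ≡⟨ countAA-block-++ p' (α p p' Y) ⟩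
    p' ∸ 1 + countAA (α p p' Y)                           ≡⟨ cong (p' ∸ 1 +_) (countAA-α Y) ⟩
    p' ∸ 1 + ((p ∸ 1) * count a Y + (p' ∸ 1) * count b Y) ≡⟨ blocks-step′ (p ∸ 1) (p' ∸ 1) (count a Y) (count b Y) ⟩
    (p ∸ 1) * count a Y + (p' ∸ 1) * suc (count b Y)      ∎

  length-α : ∀ Y → length (α p p' Y) ≡ (p * count a Y + p' * count b Y) + length Y
  length-α Y = trans (length≡count-a+count-b (α p p' Y))
                     (cong₂ _+_ (count-a-α Y) (count-b-α Y))

length-K-letter : ∀ X l → length (K X (l ∷ [])) ≡ count l X
length-K-letter X l = trans (length-K X (l ∷ [])) (occurrenceCount-letter l X)

length-K-aa : ∀ X → length (K X cAA) ≡ countAA X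
length-K-aa X = trans (length-K X cAA) (occurrenceCount-aa X)

length-KAll : ∀ X → length (KAll X) ≡ count a X + (countAA X + count b X)
length-KAll X = begin
  length (K X cA ++ K X cAA ++ K X cB)
    ≡⟨ length-++ (K X cA) ⟩
  length (K X cA) + length (K X cAA ++ K X cB)
    ≡⟨ cong (length (K X cA) +_) (length-++ (K X cAA)) ⟩
  length (K X cA) + (length (K X cAA) + length (K X cB))
    ≡⟨ cong₂ _+_ (length-K-letter X a) (cong₂ _+_ (length-K-aa X) (length-K-letter X b)) ⟩
  count a X + (countAA X + count b X) ∎

-- For p, p' ≥ 1 the three counts add up to twice the number of letters a.
length-KAll-α : ∀ q q' Y →
  length (KAll (α (suc q) (suc q') Y)) ≡ 2 * (suc q * count a Y + suc q' * count b Y)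
length-KAll-α q q' Y = begin
  length (KAll X)
    ≡⟨ length-KAll X ⟩
  count a X + (countAA X + count b X)
    ≡⟨ cong₂ _+_ (count-a-α (suc q) (suc q') Y)
                 (cong₂ _+_ (countAA-α (suc q) (suc q') Y)
                            (trans (count-b-α (suc q) (suc q') Y) (length≡count-a+count-b Y))) ⟩
  suc q * m + suc q' * n + (q * m + q' * n + (m + n))
    ≡⟨ sum-of-counts q q' m n ⟩
  2 * (suc q * m + suc q' * n) ∎
  where
  X : Word
  X = α (suc q) (suc q') Y
  m n : ℕ
  m = count a Y
  n = count b Y
  sum-of-counts : ∀ q q' m n →
    suc q * m + suc q' * n + (q * m + q' * n + (m + n)) ≡ 2 * (suc q * m + suc q' * n)
  sum-of-counts = solve-∀

length-KAll-α≡2∣X∣∸2∣Y∣ : ∀ q q' Y →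
  length (KAll (α (suc q) (suc q') Y)) ≡ 2 * length (α (suc q) (suc q') Y) ∸ 2 * length Y
length-KAll-α≡2∣X∣∸2∣Y∣ q q' Y = begin
  length (KAll (α (suc q) (suc q') Y))      ≡⟨ length-KAll-α q q' Y ⟩
  2 * A                                     ≡⟨ sym (m+n∸n≡m (2 * A) (2 * length Y)) ⟩
  2 * A + 2 * length Y ∸ 2 * length Y       ≡⟨ cong (_∸ 2 * length Y) (sym (*-distribˡ-+ 2 A (length Y))) ⟩
  2 * (A + length Y) ∸ 2 * length Y         ≡⟨ cong (λ l → 2 * l ∸ 2 * length Y) (sym (length-α (suc q) (suc q') Y)) ⟩
  2 * length (α (suc q) (suc q') Y) ∸ 2 * length Y ∎
  where
  A : ℕ
  A = suc q * count a Y + suc q' * count b Y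

length-KAll-α-longer-a : ∀ r Y →
  length (KAll (α (suc (suc r)) (suc r) Y)) ≡ 2 * count a Y + 2 * suc r * length Y
length-KAll-α-longer-a r Y = begin
  length (KAll (α (suc (suc r)) (suc r) Y)) ≡⟨ length-KAll-α (suc r) r Y ⟩
  2 * (suc (suc r) * m + suc r * n)         ≡⟨ split (suc r) m n ⟩
  2 * m + 2 * suc r * (m + n)               ≡⟨ cong (λ l → 2 * m + 2 * suc r * l) (sym (length≡count-a+count-b Y)) ⟩
  2 * m + 2 * suc r * length Y              ∎
  where
  m n : ℕ
  m = count a Y
  n = count b Y
  split : ∀ s m n → 2 * (suc s * m + s * n) ≡ 2 * m + 2 * s * (m + n)
  split = solve-∀

length-KAll-α-longer-b : ∀ r Y →
  length (KAll (α (suc r) (suc (suc r)) Y)) ≡ 2 * count b Y + 2 * suc r * length Y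
length-KAll-α-longer-b r Y = begin
  length (KAll (α (suc r) (suc (suc r)) Y)) ≡⟨ length-KAll-α r (suc r) Y ⟩
  2 * (suc r * m + suc (suc r) * n)         ≡⟨ split (suc r) m n ⟩
  2 * n + 2 * suc r * (m + n)               ≡⟨ cong (λ l → 2 * n + 2 * suc r * l) (sym (length≡count-a+count-b Y)) ⟩
  2 * n + 2 * suc r * length Y              ∎
  where
  m n : ℕ
  m = count a Y
  n = count b Y
  split : ∀ s m n → 2 * (s * m + suc s * n) ≡ 2 * n + 2 * s * (m + n)
  split = solve-∀

theorem1 : (p p' : ℕ) → 1 ≤ p → 1 ≤ p' → (p' ≡ suc p ⊎ p ≡ suc p') →
    (Y : Word) → FiniteSturmian (α p p' Y) →
    (length (K (α p p' Y) cA) ≡ p * count a Y + p' * count b Y)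
    × (length (K (α p p' Y) cB) ≡ length Y)
    × (length (K (α p p' Y) cAA) ≡ (p ∸ 1) * count a Y + (p' ∸ 1) * count b Y)
    × (length (KAll (α p p' Y)) ≡ 2 * length (α p p' Y) ∸ 2 * length Y)
    × (p' < p → length (KAll (α p p' Y)) ≡ 2 * count a Y + 2 * p' * length Y)
    × (p < p' → length (KAll (α p p' Y)) ≡ 2 * count b Y + 2 * p * length Y)
theorem1 p@(suc q) p'@(suc q') _ _ adjacent Y _ =
    trans (length-K-letter X a) (count-a-α p p' Y)
  , trans (length-K-letter X b) (count-b-α p p' Y)
  , trans (length-K-aa X) (countAA-α p p' Y)
  , length-KAll-α≡2∣X∣∸2∣Y∣ q q' Y
  , p'<p-case adjacent
  , p<p'-case adjacent
  where
  X : Word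
  X = α p p' Y
  p'<p-case : p' ≡ suc p ⊎ p ≡ suc p' → p' < p → length (KAll X) ≡ 2 * count a Y + 2 * p' * length Y
  p'<p-case (inj₁ refl) p'<p = ⊥-elim (<-asym p'<p (n<1+n p))
  p'<p-case (inj₂ refl) _    = length-KAll-α-longer-a q' Y
  p<p'-case : p' ≡ suc p ⊎ p ≡ suc p' → p < p' → length (KAll X) ≡ 2 * count b Y + 2 * p * length Y
  p<p'-case (inj₁ refl) _    = length-KAll-α-longer-b q Y
  p<p'-case (inj₂ refl) p<p' = ⊥-elim (<-asym p<p' (n<1+n p'))
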